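{- Let $\pi$ be a $k$-permutation, $\overline{P}_\pi(\alpha,\beta)=P_\pi(1-\alpha,\beta)$ its mirror gradient polynomial, and $i,j\in\mathbb{N}_0$. If $i\le k-2$ and $j\le k-2$, then $$c_{i,j}(\overline{P}_\pi)=\frac{k!\,(-1)^{i+j+1}}{i!\,j!\,(k-i-2)!\,(k-j-2)!}\left(\mathbf{b}_{i+2}^T\,\overline{A_\pi}\,\mathbf{b}_{j+2}\right),$$ and otherwise $c_{i,j}(\overline{P}_\pi)=0$.
   Context: $[k]=\{1,\dots,k\}$; a $k$-permutation is a bijection $\pi:[k]\to[k]$. Its permutation matrix $A_\pi\in\mathbb{R}^{k\times k}$ has $(A_\pi)_{i,j}=1$ if $\pi(i)=j$ and $0$ otherwise. For a matrix $M\in\mathbb{R}^{n\times m}$, its row mirror image $\overline{M}$ is given by $\overline{M}_{i,j}=M_{n-i+1,j}$. The gradient polynomial of $\pi$ is $P_\pi(\alpha,\beta)=k!\sum_{m\in[k]}\left(\frac{k-m}{1-\alpha}-\frac{m-1}{\alpha}\right)\left(\frac{k-\pi(m)}{1-\beta}-\frac{\pi(m)-1}{\beta}\right)\frac{\alpha^{m-1}(1-\alpha)^{k-m}\beta^{\pi(m)-1}(1-\beta)^{k-\pi(m)}}{(m-1)!(k-m)!(\pi(m)-1)!(k-\pi(m))!}$, a polynomial in $\alpha,\beta$. For a polynomial $P$, $c_{i,j}(P)$ is the coefficient of $\alpha^i\beta^j$ in $P$. For $a\in[k]$, $\mathbf{b}_a=\mathbf{b}^k_a\in\mathbb{R}^k$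 is the vector with $i$-th entry $(-1)^{i-1}\binom{a-1}{i-1}$ for $1\le i\le a$ and $0$ for $i>a$. -}

module Defs where

open import Data.Nat using (ℕ; zero; suc; _∸_; _!; _<?_)
open import Data.Nat.Properties using (_!≢0)
open import Data.Nat.Combinatorics using (_C_)
open import Data.Integer using (ℤ; +_)
open import Data.Fin using (Fin; toℕ; opposite)
open import Data.Fin.Permutation using (Permutation′; _⟨$⟩ʳ_)
open import Data.Rational using (ℚ; 0ℚ; 1ℚ; _+_; _*_; _-_; -_; _/_)
open import Relation.Nullary using (yes; no)
open import Relation.Binary.PropositionalEquality using (_≡_)
open import Relation.Nullary.Decidable using (⌊_⌋)
open import Data.Bool using (if_then_else_)
open import Data.Fin using (_≟_)

ℕ→ℚ : ℕ → ℚ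
ℕ→ℚ n = (+ n) / 1

inv! : ℕ → ℚ
inv! n = (+ 1) / (n !)
  where instance _ = n !≢0

sgn : ℕ → ℚ
sgn zero    = 1ℚ
sgn (suc n) = - sgn n

ΣFin : (k : ℕ) → (Fin k → ℚ) → ℚ
ΣFin zero    f = 0ℚ
ΣFin (suc k) f = f Fin.zero + ΣFin k (λ i → f (Fin.suc i))
  where import Data.Fin as Fin

Σ≤ : ℕ → (ℕ → ℚ) → ℚ
Σ≤ zero    f = f 0
Σ≤ (suc n) f = f (suc n) + Σ≤ n f

-- Bivariate polynomials over ℚ in α, β, represented by their
-- coefficient function: P i j = coefficient of α^i β^j.

Poly2 : Set
Poly2 = ℕ → ℕ → ℚ

coeff : ℕ → ℕ → Poly2 → ℚ
coeff i j P = P i j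

constP : ℚ → Poly2
constP q zero zero = q
constP q _    _    = 0ℚ

oneP : Poly2
oneP = constP 1ℚ

αP : Poly2
αP (suc zero) zero = 1ℚ
αP _          _    = 0ℚ

βP : Poly2
βP zero (suc zero) = 1ℚ
βP _    _          = 0ℚ

_⊕_ : Poly2 → Poly2 → Poly2
(P ⊕ Q) i j = P i j + Q i j

_⊖_ : Poly2 → Poly2 → Poly2
(P ⊖ Q) i j = P i j - Q i j

_·_ : ℚ → Poly2 → Poly2
(q · P) i j = q * P i j

_⊗_ : Poly2 → Poly2 → Poly2
(P ⊗ Q) i j = Σ≤ i (λ a → Σ≤ j (λ b → P a b * Q (i ∸ a) (j ∸ b)))

_^P_ : Poly2 → ℕ → Poly2
P ^P zero  = oneP
P ^P suc n = P ⊗ (P ^P n)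

ΣP : (k : ℕ) → (Fin k → Poly2) → Poly2
ΣP k F i j = ΣFin k (λ m → F m i j)

infixl 6 _⊕_ _⊖_
infixl 7 _⊗_ _·_

-- The gradient polynomial P_π(a, b), evaluated at polynomials a, b
-- (so P_π = gradPoly π αP βP and P_π(1-α, β) = gradPoly π (1-α) β).
--
-- Indices m : Fin k are 0-based: toℕ m = m - 1 in the paper.
-- The factor ((k-m)/(1-a) - (m-1)/a) · a^{m-1} (1-a)^{k-m} is written
-- after cancelling the (formal) divisions:
--   (k-m) a^{m-1} (1-a)^{k-m-1} - (m-1) a^{m-2} (1-a)^{k-m},
-- where a term whose scalar factor (k-m) resp. (m-1) is 0 vanishes
-- (so the truncated exponent k∸m∸1 resp. m∸2 is irrelevant there).

gradFactor : (k r : ℕ) → Poly2 → Poly2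
gradFactor k r a =
    ℕ→ℚ (k ∸ suc r) · (a ^P r) ⊗ ((oneP ⊖ a) ^P (k ∸ suc r ∸ 1))
  ⊖ ℕ→ℚ r · (a ^P (r ∸ 1)) ⊗ ((oneP ⊖ a) ^P (k ∸ suc r))

gradPoly : {k : ℕ} → Permutation′ k → Poly2 → Poly2 → Poly2
gradPoly {k} π a b = ΣP k term
  where
  term : Fin k → Poly2
  term m =
    let r = toℕ m
        s = toℕ (π ⟨$⟩ʳ m)
    in (ℕ→ℚ (k !) * inv! r * inv! (k ∸ suc r) * inv! s * inv! (k ∸ suc s))
         · gradFactor k r a ⊗ gradFactor k s b

P : {k : ℕ} → Permutation′ k → Poly2
P π = gradPoly π αP βP

Pbar : {k : ℕ} → Permutation′ k → Poly2
Pbar π = gradPoly π (oneP ⊖ αP) βP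

Matrix : ℕ → ℕ → Set
Matrix n m = Fin n → Fin m → ℚ

Vector : ℕ → Set
Vector n = Fin n → ℚ

permMatrix : {k : ℕ} → Permutation′ k → Matrix k k
permMatrix π i j with (π ⟨$⟩ʳ i) ≟ j
... | yes _ = 1ℚ
... | no  _ = 0ℚ

rowMirror : {n m : ℕ} → Matrix n m → Matrix n m
rowMirror M i j = M (opposite i) j

-- b^k_a : entry i (1-based) is (-1)^{i-1} C(a-1, i-1) for i ≤ a, 0 else.
-- With 0-based r = i - 1: (-1)^r C(a-1, r) if r < a, else 0.
bvec : (k a : ℕ) → Vector k
bvec k a r with toℕ r <? a
... | yes _ = sgn (toℕ r) * ℕ→ℚ ((a ∸ 1) C toℕ r)
... | no  _ = 0ℚ

bilinear : {n m : ℕ} → Vector n → Matrix n m → Vector m → ℚ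
bilinear {n} {m} u M v = ΣFin n (λ i → ΣFin m (λ j → u i * M i j * v j))

{-# OPTIONS --safe #-}
-- The m-th summand of P_π is a scalar times g_{m-1,k-m}(α) g_{π(m)-1,k-π(m)}(β), where
-- g_{s,t}(x) = t x^s (1 - x)^(t-1) - s x^(s-1) (1 - x)^t is minus the derivative of x^s (1 - x)^t.
-- So the coefficient of x^j in g_{s,t} is -(j+1) (-1)^n C(t, n) with s + n = j + 1; divided by
-- s! t! this is (-1)^j / (j! (s+t-1-j)!) times the entry of b_{j+2} at position s, and it
-- vanishes for j ≥ s + t = k - 1.  Since g_{s,t}(1 - x) = -g_{t,s}(x), substituting 1 - α
-- moves the α-index from m - 1 to k - m, which is the row mirror of A_π, and contributes the
-- extra sign.
module Submission where

open import Defs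
open import Data.Nat as ℕ using (ℕ; zero; suc; _+_; _∸_; _≤_; _<_; z≤n; s≤s; _!)
import Data.Nat.Properties as ℕ
open import Data.Nat.Combinatorics
  using (_C_; nCk≡n!/k![n-k]!; k![n∸k]!∣n!; k>n⇒nCk≡0; nCk+nC[k+1]≡[n+1]C[k+1])
open import Data.Nat.DivMod using (m/n*n≡m)
open import Data.Nat.Coprimality as Coprime using (1-coprimeTo)
open import Data.Integer as ℤ using (+_)
import Data.Integer.Properties as ℤ
open import Data.Fin as Fin using (Fin; toℕ; opposite)
import Data.Fin.Properties as Fin
open import Data.Fin.Permutation using (Permutation′; _⟨$⟩ʳ_; reverse)
open import Data.Rational as ℚ using (ℚ; 0ℚ; 1ℚ; _*_; _-_; -_; mkℚ)
open import Data.Rational.Properties as ℚ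
  using (+-*-commutativeRing; normalize-coprime; /-cong; *-inverseˡ)
open import Algebra.Bundles using (CommutativeRing)
open import Algebra.Properties.Semiring.Sum (CommutativeRing.semiring +-*-commutativeRing)
  using (sum; sum-cong-≗; sum-remove; sum-replicate-zero; *-distribˡ-sum; sum-permute)
open import Data.Maybe using (Maybe; just; nothing)
open import Data.Product using (_×_; _,_)
open import Data.Sum using ([_,_]′)
open import Function using (_∘_)
open import Relation.Nullary using (¬_; Dec; yes; no; contradiction)
open import Relation.Binary.PropositionalEquality
open import Tactic.RingSolver using (solve-∀)
open import Tactic.RingSolver.Core.AlmostCommutativeRing
  using (AlmostCommutativeRing; fromCommutativeRing)

open ≡-Reasoning

ℚ-ring : AlmostCommutativeRing _ _
ℚ-ring = fromCommutativeRing +-*-commutativeRing isZero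
  where
  isZero : ∀ x → Maybe (0ℚ ≡ x)
  isZero x with 0ℚ ℚ.≟ x
  ... | yes p = just p
  ... | no _  = nothing

-- Naturals, factorials and signs in ℚ

ℕ→ℚ≡mkℚ : ∀ n → ℕ→ℚ n ≡ mkℚ (+ n) 0 (Coprime.sym (1-coprimeTo n))
ℕ→ℚ≡mkℚ n = normalize-coprime (Coprime.sym (1-coprimeTo n))

ℕ→ℚ-+ : ∀ m n → ℕ→ℚ (m + n) ≡ ℕ→ℚ m ℚ.+ ℕ→ℚ n
ℕ→ℚ-+ m n rewrite ℕ→ℚ≡mkℚ m | ℕ→ℚ≡mkℚ n =
  /-cong (sym (cong₂ ℤ._+_ (ℤ.*-identityʳ (+ m)) (ℤ.*-identityʳ (+ n)))) refl

ℕ→ℚ-* : ∀ m n → ℕ→ℚ (m ℕ.* n) ≡ ℕ→ℚ m * ℕ→ℚ n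
ℕ→ℚ-* m n rewrite ℕ→ℚ≡mkℚ m | ℕ→ℚ≡mkℚ n = /-cong (ℤ.pos-* m n) refl

inv!-*-! : ∀ n → inv! n * ℕ→ℚ (n !) ≡ 1ℚ
inv!-*-! n with n ! | n ℕ.!≢0
... | suc d | _ rewrite ℕ→ℚ≡mkℚ (suc d) | normalize-coprime {1} {d} (1-coprimeTo (suc d)) =
  *-inverseˡ (mkℚ (+ suc d) 0 (Coprime.sym (1-coprimeTo (suc d))))

inv!-*-suc! : ∀ n → inv! n * ℕ→ℚ (suc n !) ≡ ℕ→ℚ (suc n)
inv!-*-suc! n = begin
  inv! n * ℕ→ℚ (suc n !)                  ≡⟨ cong (inv! n *_) (ℕ→ℚ-* (suc n) (n !)) ⟩
  inv! n * (ℕ→ℚ (suc n) * ℕ→ℚ (n !))      ≡⟨ regroup (inv! n) (ℕ→ℚ (suc n)) (ℕ→ℚ (n !)) ⟩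
  ℕ→ℚ (suc n) * (inv! n * ℕ→ℚ (n !))      ≡⟨ cong (ℕ→ℚ (suc n) *_) (inv!-*-! n) ⟩
  ℕ→ℚ (suc n) * 1ℚ                        ≡⟨ ℚ.*-identityʳ (ℕ→ℚ (suc n)) ⟩
  ℕ→ℚ (suc n)                             ∎
  where
  regroup : ∀ a b c → a * (b * c) ≡ b * (a * c)
  regroup = solve-∀ ℚ-ring

suc-*-inv!-suc : ∀ n → ℕ→ℚ (suc n) * inv! (suc n) ≡ inv! n
suc-*-inv!-suc n = begin
  ℕ→ℚ (suc n) * inv! (suc n)                   ≡⟨ cong (_* inv! (suc n)) (inv!-*-suc! n) ⟨
  inv! n * ℕ→ℚ (suc n !) * inv! (suc n)        ≡⟨ regroup (inv! n) (ℕ→ℚ (suc n !)) (inv! (suc n)) ⟩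
  inv! n * (inv! (suc n) * ℕ→ℚ (suc n !))      ≡⟨ cong (inv! n *_) (inv!-*-! (suc n)) ⟩
  inv! n * 1ℚ                                  ≡⟨ ℚ.*-identityʳ (inv! n) ⟩
  inv! n                                       ∎
  where
  regroup : ∀ a b c → a * b * c ≡ a * (c * b)
  regroup = solve-∀ ℚ-ring

nCk*k!*[n∸k]!≡n! : ∀ {n k} → k ≤ n → (n C k) ℕ.* (k ! ℕ.* (n ∸ k) !) ≡ n !
nCk*k!*[n∸k]!≡n! {n} {k} k≤n =
  trans (cong (ℕ._* (k ! ℕ.* (n ∸ k) !)) (nCk≡n!/k![n-k]! k≤n)) (m/n*n≡m {{_}} (k![n∸k]!∣n! k≤n))

[m+n]Cm*m!*n!≡[m+n]! : ∀ m n → ((m + n) C m) ℕ.* (m ! ℕ.* n !) ≡ (m + n) !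
[m+n]Cm*m!*n!≡[m+n]! m n =
  subst (λ x → ((m + n) C m) ℕ.* (m ! ℕ.* x !) ≡ (m + n) !) (ℕ.m+n∸m≡n m n)
        (nCk*k!*[n∸k]!≡n! (ℕ.m≤m+n m n))

ℕ→ℚ[m+nCm] : ∀ m n → ℕ→ℚ ((m + n) C m) ≡ ℕ→ℚ ((m + n) !) * inv! m * inv! n
ℕ→ℚ[m+nCm] m n = begin
  c                                                    ≡⟨ regroup₁ c (inv! m) (inv! n) ⟩
  c * 1ℚ * 1ℚ                                          ≡⟨ cong₂ (λ x y → c * x * y) (inv!-*-! m) (inv!-*-! n) ⟨
  c * (inv! m * ℕ→ℚ (m !)) * (inv! n * ℕ→ℚ (n !))      ≡⟨ regroup₂ c (inv! m) (ℕ→ℚ (m !)) (inv! n) (ℕ→ℚ (n !)) ⟩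
  c * (ℕ→ℚ (m !) * ℕ→ℚ (n !)) * inv! m * inv! n        ≡⟨ cong (λ x → x * inv! m * inv! n) product ⟩
  ℕ→ℚ ((m + n) !) * inv! m * inv! n                    ∎
  where
  c = ℕ→ℚ ((m + n) C m)
  regroup₁ : ∀ c a b → c ≡ c * 1ℚ * 1ℚ
  regroup₁ = solve-∀ ℚ-ring
  regroup₂ : ∀ c a x b y → c * (a * x) * (b * y) ≡ c * (x * y) * a * b
  regroup₂ = solve-∀ ℚ-ring
  product : c * (ℕ→ℚ (m !) * ℕ→ℚ (n !)) ≡ ℕ→ℚ ((m + n) !)
  product = begin
    c * (ℕ→ℚ (m !) * ℕ→ℚ (n !))            ≡⟨ cong (c *_) (ℕ→ℚ-* (m !) (n !)) ⟨
    c * ℕ→ℚ (m ! ℕ.* n !)                  ≡⟨ ℕ→ℚ-* ((m + n) C m) (m ! ℕ.* n !) ⟨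
    ℕ→ℚ (((m + n) C m) ℕ.* (m ! ℕ.* n !))    ≡⟨ cong ℕ→ℚ ([m+n]Cm*m!*n!≡[m+n]! m n) ⟩
    ℕ→ℚ ((m + n) !)                        ∎

inv!-*-ℕ→ℚ[m+nCm] : ∀ m n → inv! (m + n) * ℕ→ℚ ((m + n) C m) ≡ inv! m * inv! n
inv!-*-ℕ→ℚ[m+nCm] m n = begin
  inv! (m + n) * ℕ→ℚ ((m + n) C m)                           ≡⟨ cong (inv! (m + n) *_) (ℕ→ℚ[m+nCm] m n) ⟩
  inv! (m + n) * (ℕ→ℚ ((m + n) !) * inv! m * inv! n)         ≡⟨ regroup (inv! (m + n)) (ℕ→ℚ ((m + n) !)) (inv! m) (inv! n) ⟩
  inv! (m + n) * ℕ→ℚ ((m + n) !) * (inv! m * inv! n)         ≡⟨ cong (_* (inv! m * inv! n)) (inv!-*-! (m + n)) ⟩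
  1ℚ * (inv! m * inv! n)                                     ≡⟨ ℚ.*-identityˡ _ ⟩
  inv! m * inv! n                                            ∎
  where
  regroup : ∀ a b c d → a * (b * c * d) ≡ a * b * (c * d)
  regroup = solve-∀ ℚ-ring

absorption-+ : ∀ n e → ℕ→ℚ (suc (n + e)) * ℕ→ℚ ((n + e) C n) ≡ ℕ→ℚ (suc n) * ℕ→ℚ (suc (n + e) C suc n)
absorption-+ n e = begin
  ℕ→ℚ (suc (n + e)) * ℕ→ℚ ((n + e) C n)                                  ≡⟨ cong (ℕ→ℚ (suc (n + e)) *_) (ℕ→ℚ[m+nCm] n e) ⟩
  ℕ→ℚ (suc (n + e)) * (ℕ→ℚ ((n + e) !) * inv! n * inv! e)                ≡⟨ regroup₁ (ℕ→ℚ (suc (n + e))) (ℕ→ℚ ((n + e) !)) (inv! n) (inv! e) ⟩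
  ℕ→ℚ (suc (n + e)) * ℕ→ℚ ((n + e) !) * inv! n * inv! e                  ≡⟨ cong (λ x → x * inv! n * inv! e) (ℕ→ℚ-* (suc (n + e)) ((n + e) !)) ⟨
  ℕ→ℚ (suc (n + e) !) * inv! n * inv! e                                  ≡⟨ cong (λ x → ℕ→ℚ (suc (n + e) !) * x * inv! e) (suc-*-inv!-suc n) ⟨
  ℕ→ℚ (suc (n + e) !) * (ℕ→ℚ (suc n) * inv! (suc n)) * inv! e            ≡⟨ regroup₂ (ℕ→ℚ (suc (n + e) !)) (ℕ→ℚ (suc n)) (inv! (suc n)) (inv! e) ⟩
  ℕ→ℚ (suc n) * (ℕ→ℚ (suc (n + e) !) * inv! (suc n) * inv! e)            ≡⟨ cong (ℕ→ℚ (suc n) *_) (ℕ→ℚ[m+nCm] (suc n) e) ⟨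
  ℕ→ℚ (suc n) * ℕ→ℚ (suc (n + e) C suc n)                                ∎
  where
  regroup₁ : ∀ a b c d → a * (b * c * d) ≡ a * b * c * d
  regroup₁ = solve-∀ ℚ-ring
  regroup₂ : ∀ f a b c → f * (a * b) * c ≡ a * (f * b * c)
  regroup₂ = solve-∀ ℚ-ring

absorption : ∀ t n → ℕ→ℚ t * ℕ→ℚ ((t ∸ 1) C n) ≡ ℕ→ℚ (suc n) * ℕ→ℚ (t C suc n)
absorption zero    n = trans (ℚ.*-zeroˡ (ℕ→ℚ (0 C n))) (sym (ℚ.*-zeroʳ (ℕ→ℚ (suc n))))
absorption (suc t) n = [ n≤t-case , t<n-case ]′ (ℕ.≤-<-connex n t)
  where
  n≤t-case : n ≤ t → ℕ→ℚ (suc t) * ℕ→ℚ (t C n) ≡ ℕ→ℚ (suc n) * ℕ→ℚ (suc t C suc n)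
  n≤t-case n≤t =
    subst (λ t → ℕ→ℚ (suc t) * ℕ→ℚ (t C n) ≡ ℕ→ℚ (suc n) * ℕ→ℚ (suc t C suc n)) (ℕ.m+[n∸m]≡n n≤t) (absorption-+ n (t ∸ n))
  t<n-case : t < n → ℕ→ℚ (suc t) * ℕ→ℚ (t C n) ≡ ℕ→ℚ (suc n) * ℕ→ℚ (suc t C suc n)
  t<n-case t<n = begin
    ℕ→ℚ (suc t) * ℕ→ℚ (t C n)              ≡⟨ cong (λ x → ℕ→ℚ (suc t) * ℕ→ℚ x) (k>n⇒nCk≡0 t<n) ⟩
    ℕ→ℚ (suc t) * 0ℚ                       ≡⟨ ℚ.*-zeroʳ (ℕ→ℚ (suc t)) ⟩
    0ℚ                                     ≡⟨ ℚ.*-zeroʳ (ℕ→ℚ (suc n)) ⟨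
    ℕ→ℚ (suc n) * 0ℚ                       ≡⟨ cong (λ x → ℕ→ℚ (suc n) * ℕ→ℚ x) (k>n⇒nCk≡0 (s≤s t<n)) ⟨
    ℕ→ℚ (suc n) * ℕ→ℚ (suc t C suc n)      ∎

sgn-+ : ∀ m n → sgn (m + n) ≡ sgn m * sgn n
sgn-+ zero    n = sym (ℚ.*-identityˡ (sgn n))
sgn-+ (suc m) n = trans (cong -_ (sgn-+ m n)) (neg-* (sgn m) (sgn n))
  where
  neg-* : ∀ x y → - (x * y) ≡ - x * y
  neg-* = solve-∀ ℚ-ring

sgn-*-sgn : ∀ n → sgn n * sgn n ≡ 1ℚ
sgn-*-sgn zero    = refl
sgn-*-sgn (suc n) = trans (neg-*-neg (sgn n)) (sgn-*-sgn n)
  where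
  neg-*-neg : ∀ x → - x * - x ≡ x * x
  neg-*-neg = solve-∀ ℚ-ring

-- Finite sums

Σ≤-cong : ∀ n {f g : ℕ → ℚ} → (∀ a → a ≤ n → f a ≡ g a) → Σ≤ n f ≡ Σ≤ n g
Σ≤-cong zero    f≡g = f≡g 0 z≤n
Σ≤-cong (suc n) f≡g = cong₂ ℚ._+_ (f≡g (suc n) ℕ.≤-refl) (Σ≤-cong n (λ a a≤n → f≡g a (ℕ.m≤n⇒m≤1+n a≤n)))

Σ≤-0 : ∀ n → Σ≤ n (λ _ → 0ℚ) ≡ 0ℚ
Σ≤-0 zero    = refl
Σ≤-0 (suc n) = trans (ℚ.+-identityˡ _) (Σ≤-0 n)

Σ≤-suc : ∀ n (f : ℕ → ℚ) → Σ≤ (suc n) f ≡ f 0 ℚ.+ Σ≤ n (f ∘ suc)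
Σ≤-suc zero    f = ℚ.+-comm (f 1) (f 0)
Σ≤-suc (suc n) f = trans (cong (f (suc (suc n)) ℚ.+_) (Σ≤-suc n f)) (swap (f (suc (suc n))) (f 0) (Σ≤ n (f ∘ suc)))
  where
  swap : ∀ x y z → x ℚ.+ (y ℚ.+ z) ≡ y ℚ.+ (x ℚ.+ z)
  swap = solve-∀ ℚ-ring

Σ≤-reverse : ∀ n (f : ℕ → ℚ) → Σ≤ n (λ a → f (n ∸ a)) ≡ Σ≤ n f
Σ≤-reverse zero    f = refl
Σ≤-reverse (suc n) f = trans (Σ≤-suc n (λ a → f (suc n ∸ a))) (cong (f (suc n) ℚ.+_) (Σ≤-reverse n f))

Σ≤-- : ∀ n (f g : ℕ → ℚ) → Σ≤ n (λ a → f a - g a) ≡ Σ≤ n f - Σ≤ n g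
Σ≤-- zero    f g = refl
Σ≤-- (suc n) f g = trans (cong (f (suc n) - g (suc n) ℚ.+_) (Σ≤-- n f g)) (interchange (f (suc n)) (g (suc n)) (Σ≤ n f) (Σ≤ n g))
  where
  interchange : ∀ a b c d → a - b ℚ.+ (c - d) ≡ a ℚ.+ c - (b ℚ.+ d)
  interchange = solve-∀ ℚ-ring

*-distribˡ-Σ≤ : ∀ n c (f : ℕ → ℚ) → c * Σ≤ n f ≡ Σ≤ n (λ a → c * f a)
*-distribˡ-Σ≤ zero    c f = refl
*-distribˡ-Σ≤ (suc n) c f = trans (ℚ.*-distribˡ-+ c (f (suc n)) (Σ≤ n f)) (cong (c * f (suc n) ℚ.+_) (*-distribˡ-Σ≤ n c f))

*-distribʳ-Σ≤ : ∀ n c (f : ℕ → ℚ) → Σ≤ n f * c ≡ Σ≤ n (λ a → f a * c)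
*-distribʳ-Σ≤ zero    c f = refl
*-distribʳ-Σ≤ (suc n) c f = trans (ℚ.*-distribʳ-+ c (f (suc n)) (Σ≤ n f)) (cong (f (suc n) * c ℚ.+_) (*-distribʳ-Σ≤ n c f))

Σ≤-*-Σ≤ : ∀ m n (f g : ℕ → ℚ) → Σ≤ m f * Σ≤ n g ≡ Σ≤ m (λ a → Σ≤ n (λ b → f a * g b))
Σ≤-*-Σ≤ m n f g = trans (*-distribʳ-Σ≤ m (Σ≤ n g) f) (Σ≤-cong m (λ a _ → *-distribˡ-Σ≤ n (f a) g))

ΣFin≡sum : ∀ k (f : Fin k → ℚ) → ΣFin k f ≡ sum f
ΣFin≡sum zero    f = refl
ΣFin≡sum (suc k) f = cong (f Fin.zero ℚ.+_) (ΣFin≡sum k (f ∘ Fin.suc))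

ΣFin-cong : ∀ k {f g : Fin k → ℚ} → f ≗ g → ΣFin k f ≡ ΣFin k g
ΣFin-cong k {f} {g} f≗g = trans (ΣFin≡sum k f) (trans (sum-cong-≗ f≗g) (sym (ΣFin≡sum k g)))

ΣFin-0 : ∀ k → ΣFin k (λ _ → 0ℚ) ≡ 0ℚ
ΣFin-0 k = trans (ΣFin≡sum k (λ _ → 0ℚ)) (sum-replicate-zero k)

ΣFin-δ : ∀ {k} (z : Fin k) (f : Fin k → ℚ) → (∀ y → y ≢ z → f y ≡ 0ℚ) → ΣFin k f ≡ f z
ΣFin-δ {suc k} z f f≡0 = begin
  ΣFin (suc k) f                    ≡⟨ ΣFin≡sum (suc k) f ⟩
  sum f                             ≡⟨ sum-remove {i = z} f ⟩
  f z ℚ.+ sum (f ∘ Fin.punchIn z)   ≡⟨ cong (f z ℚ.+_) (sum-cong-≗ (λ y → f≡0 _ (Fin.punchInᵢ≢i z y))) ⟩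
  f z ℚ.+ sum {k} (λ _ → 0ℚ)        ≡⟨ cong (f z ℚ.+_) (sum-replicate-zero k) ⟩
  f z ℚ.+ 0ℚ                        ≡⟨ ℚ.+-identityʳ (f z) ⟩
  f z                               ∎

ΣFin-opposite : ∀ k (f : Fin k → ℚ) → ΣFin k (f ∘ opposite) ≡ ΣFin k f
ΣFin-opposite k f = begin
  ΣFin k (f ∘ opposite)  ≡⟨ ΣFin≡sum k (f ∘ opposite) ⟩
  sum (f ∘ opposite)     ≡⟨ sum-permute f reverse ⟨
  sum f                  ≡⟨ ΣFin≡sum k f ⟨
  ΣFin k f               ∎

*-distribˡ-ΣFin : ∀ k c (f : Fin k → ℚ) → c * ΣFin k f ≡ ΣFin k (λ x → c * f x)
*-distribˡ-ΣFin k c f = begin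
  c * ΣFin k f               ≡⟨ cong (c *_) (ΣFin≡sum k f) ⟩
  c * sum f                  ≡⟨ *-distribˡ-sum c f ⟩
  sum (λ x → c * f x)        ≡⟨ ΣFin≡sum k (λ x → c * f x) ⟨
  ΣFin k (λ x → c * f x)     ∎

-- Univariate polynomials as coefficient sequences

Poly1 : Set
Poly1 = ℕ → ℚ

𝟙 : Poly1
𝟙 zero    = 1ℚ
𝟙 (suc _) = 0ℚ

shift : ℕ → Poly1 → Poly1
shift zero    f i       = f i
shift (suc q) f zero    = 0ℚ
shift (suc q) f (suc i) = shift q f i

X^_ : ℕ → Poly1
X^ q = shift q 𝟙

X : Poly1
X = X^ 1

_⊖₁_ : Poly1 → Poly1 → Poly1
(f ⊖₁ g) i = f i - g i

_·₁_ : ℚ → Poly1 → Poly1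
(c ·₁ f) i = c * f i

_⋆_ : Poly1 → Poly1 → Poly1
(f ⋆ g) i = Σ≤ i (λ a → f a * g (i ∸ a))

_^_ : Poly1 → ℕ → Poly1
f ^ zero  = 𝟙
f ^ suc n = f ⋆ (f ^ n)

infixl 6 _⊖₁_
infixl 7 _⋆_ _·₁_
infixr 8 _^_

shift-+ : ∀ q f x → shift q f (q + x) ≡ f x
shift-+ zero    f x = refl
shift-+ (suc q) f x = shift-+ q f x

shift-< : ∀ q f {i} → i < q → shift q f i ≡ 0ℚ
shift-< (suc q) f {zero}  _           = refl
shift-< (suc q) f {suc i} (s≤s i<q) = shift-< q f i<q

⋆-cong : ∀ {f f′ g g′} → f ≗ f′ → g ≗ g′ → f ⋆ g ≗ f′ ⋆ g′
⋆-cong f≗f′ g≗g′ i = Σ≤-cong i (λ a _ → cong₂ _*_ (f≗f′ a) (g≗g′ (i ∸ a)))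

⋆-congʳ : ∀ f {g g′} → g ≗ g′ → f ⋆ g ≗ f ⋆ g′
⋆-congʳ f = ⋆-cong {f} {f} (λ _ → refl)

⋆-comm : ∀ f g → f ⋆ g ≗ g ⋆ f
⋆-comm f g i = begin
  Σ≤ i (λ a → f a * g (i ∸ a))                ≡⟨ Σ≤-reverse i (λ a → f a * g (i ∸ a)) ⟨
  Σ≤ i (λ a → f (i ∸ a) * g (i ∸ (i ∸ a)))    ≡⟨ Σ≤-cong i (λ a a≤i → trans (ℚ.*-comm (f (i ∸ a)) (g (i ∸ (i ∸ a)))) (cong (λ b → g b * f (i ∸ a)) (ℕ.m∸[m∸n]≡n a≤i))) ⟩
  Σ≤ i (λ a → g a * f (i ∸ a))                ∎

X^-⋆ : ∀ q f → X^ q ⋆ f ≗ shift q f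
X^-⋆ zero    f zero    = ℚ.*-identityˡ (f 0)
X^-⋆ zero    f (suc i) = begin
  Σ≤ (suc i) (λ a → 𝟙 a * f (suc i ∸ a))            ≡⟨ Σ≤-suc i (λ a → 𝟙 a * f (suc i ∸ a)) ⟩
  1ℚ * f (suc i) ℚ.+ Σ≤ i (λ a → 0ℚ * f (i ∸ a))    ≡⟨ cong₂ ℚ._+_ (ℚ.*-identityˡ (f (suc i))) (Σ≤-cong i (λ a _ → ℚ.*-zeroˡ (f (i ∸ a)))) ⟩
  f (suc i) ℚ.+ Σ≤ i (λ _ → 0ℚ)                     ≡⟨ cong (f (suc i) ℚ.+_) (Σ≤-0 i) ⟩
  f (suc i) ℚ.+ 0ℚ                                  ≡⟨ ℚ.+-identityʳ (f (suc i)) ⟩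
  f (suc i)                                         ∎
X^-⋆ (suc q) f zero    = ℚ.*-zeroˡ (f 0)
X^-⋆ (suc q) f (suc i) = begin
  Σ≤ (suc i) (λ a → (X^ suc q) a * f (suc i ∸ a))     ≡⟨ Σ≤-suc i (λ a → (X^ suc q) a * f (suc i ∸ a)) ⟩
  0ℚ * f (suc i) ℚ.+ (X^ q ⋆ f) i                   ≡⟨ cong₂ ℚ._+_ (ℚ.*-zeroˡ (f (suc i))) (X^-⋆ q f i) ⟩
  0ℚ ℚ.+ shift q f i                                ≡⟨ ℚ.+-identityˡ (shift q f i) ⟩
  shift q f i                                       ∎

𝟙-⋆ : ∀ f → 𝟙 ⋆ f ≗ f
𝟙-⋆ = X^-⋆ 0

⋆-𝟙 : ∀ f → f ⋆ 𝟙 ≗ f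
⋆-𝟙 f i = trans (⋆-comm f 𝟙 i) (𝟙-⋆ f i)

·₁-⋆ : ∀ c f g → c ·₁ f ⋆ g ≗ c ·₁ (f ⋆ g)
·₁-⋆ c f g i = trans (Σ≤-cong i (λ a _ → ℚ.*-assoc c (f a) (g (i ∸ a)))) (sym (*-distribˡ-Σ≤ i c (λ a → f a * g (i ∸ a))))

⊖₁-⋆ : ∀ f g h → (f ⊖₁ g) ⋆ h ≗ f ⋆ h ⊖₁ g ⋆ h
⊖₁-⋆ f g h i = trans (Σ≤-cong i (λ a _ → distrib (f a) (g a) (h (i ∸ a)))) (Σ≤-- i (λ a → f a * h (i ∸ a)) (λ a → g a * h (i ∸ a)))
  where
  distrib : ∀ x y z → (x - y) * z ≡ x * z - y * z
  distrib = solve-∀ ℚ-ring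

^-cong : ∀ {f g} → f ≗ g → ∀ n → f ^ n ≗ g ^ n
^-cong f≗g zero    i = refl
^-cong f≗g (suc n)   = ⋆-cong f≗g (^-cong f≗g n)

X-^ : ∀ n → X ^ n ≗ X^ n
X-^ zero    i = refl
X-^ (suc n) i = trans (⋆-congʳ X (X-^ n) i) (trans (X^-⋆ 1 (X^ n) i) (shift-X^ i))
  where
  shift-X^ : shift 1 (X^ n) ≗ X^ suc n
  shift-X^ zero    = refl
  shift-X^ (suc i) = refl

sbin : ℕ → Poly1
sbin n i = sgn i * ℕ→ℚ (n C i)

sbin-suc : ∀ n → sbin n ⊖₁ shift 1 (sbin n) ≗ sbin (suc n)
sbin-suc n zero    = ℚ.+-identityʳ (sbin n 0)
sbin-suc n (suc i) = begin
  - sgn i * ℕ→ℚ (n C suc i) - sgn i * ℕ→ℚ (n C i)      ≡⟨ pascal (sgn i) (ℕ→ℚ (n C i)) (ℕ→ℚ (n C suc i)) ⟩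
  - sgn i * (ℕ→ℚ (n C i) ℚ.+ ℕ→ℚ (n C suc i))          ≡⟨ cong (- sgn i *_) (ℕ→ℚ-+ (n C i) (n C suc i)) ⟨
  - sgn i * ℕ→ℚ (n C i + n C suc i)                    ≡⟨ cong (λ x → - sgn i * ℕ→ℚ x) (nCk+nC[k+1]≡[n+1]C[k+1] n i) ⟩
  - sgn i * ℕ→ℚ (suc n C suc i)                        ∎
  where
  pascal : ∀ s x y → - s * y - s * x ≡ - s * (x ℚ.+ y)
  pascal = solve-∀ ℚ-ring

[1-X]^ : ∀ n → (𝟙 ⊖₁ X) ^ n ≗ sbin n
[1-X]^ zero    zero    = refl
[1-X]^ zero    (suc i) = sym (ℚ.*-zeroʳ (sgn (suc i)))
[1-X]^ (suc n) i = begin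
  ((𝟙 ⊖₁ X) ⋆ (𝟙 ⊖₁ X) ^ n) i           ≡⟨ ⋆-congʳ (𝟙 ⊖₁ X) ([1-X]^ n) i ⟩
  ((𝟙 ⊖₁ X) ⋆ sbin n) i                 ≡⟨ ⊖₁-⋆ 𝟙 X (sbin n) i ⟩
  (𝟙 ⋆ sbin n) i - (X ⋆ sbin n) i       ≡⟨ cong₂ _-_ (𝟙-⋆ (sbin n) i) (X^-⋆ 1 (sbin n) i) ⟩
  sbin n i - shift 1 (sbin n) i         ≡⟨ sbin-suc n i ⟩
  sbin (suc n) i                        ∎

bern : ℕ → ℕ → Poly1
bern s t = shift s (sbin t)

X^⋆[1-X]^ : ∀ s t → X ^ s ⋆ (𝟙 ⊖₁ X) ^ t ≗ bern s t
X^⋆[1-X]^ s t i = trans (⋆-cong (X-^ s) ([1-X]^ t) i) (X^-⋆ s (sbin t) i)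

bern-vanishes : ∀ s t {i} → s + t < i → bern s t i ≡ 0ℚ
bern-vanishes s t {i} s+t<i = begin
  bern s t i                   ≡⟨ cong (bern s t) s+n≡i ⟨
  bern s t (s + n)             ≡⟨ shift-+ s (sbin t) n ⟩
  sgn n * ℕ→ℚ (t C n)          ≡⟨ cong (λ x → sgn n * ℕ→ℚ x) (k>n⇒nCk≡0 t<n) ⟩
  sgn n * 0ℚ                   ≡⟨ ℚ.*-zeroʳ (sgn n) ⟩
  0ℚ                           ∎
  where
  n = i ∸ s
  s+n≡i : s + n ≡ i
  s+n≡i = ℕ.m+[n∸m]≡n (ℕ.≤-trans (ℕ.m≤m+n s t) (ℕ.<⇒≤ s+t<i))
  t<n : t < n
  t<n = ℕ.+-cancelˡ-< s t n (subst (s + t <_) (sym s+n≡i) s+t<i)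

absorption-sbin : ∀ t n → ℕ→ℚ t * sbin (t ∸ 1) n ≡ - (ℕ→ℚ (suc n) * sbin t (suc n))
absorption-sbin t n = begin
  ℕ→ℚ t * (sgn n * ℕ→ℚ ((t ∸ 1) C n))             ≡⟨ regroup₁ (ℕ→ℚ t) (sgn n) (ℕ→ℚ ((t ∸ 1) C n)) ⟩
  sgn n * (ℕ→ℚ t * ℕ→ℚ ((t ∸ 1) C n))             ≡⟨ cong (sgn n *_) (absorption t n) ⟩
  sgn n * (ℕ→ℚ (suc n) * ℕ→ℚ (t C suc n))         ≡⟨ regroup₂ (sgn n) (ℕ→ℚ (suc n)) (ℕ→ℚ (t C suc n)) ⟩
  - (ℕ→ℚ (suc n) * (- sgn n * ℕ→ℚ (t C suc n)))   ∎
  where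
  regroup₁ : ∀ a s c → a * (s * c) ≡ s * (a * c)
  regroup₁ = solve-∀ ℚ-ring
  regroup₂ : ∀ s a c → s * (a * c) ≡ - (a * (- s * c))
  regroup₂ = solve-∀ ℚ-ring

bern-coeff : ∀ s n e → inv! s * inv! (n + e) * bern s (n + e) (s + n) ≡ sgn n * inv! s * inv! n * inv! e
bern-coeff s n e = begin
  inv! s * inv! (n + e) * bern s (n + e) (s + n)             ≡⟨ cong (inv! s * inv! (n + e) *_) (shift-+ s (sbin (n + e)) n) ⟩
  inv! s * inv! (n + e) * (sgn n * ℕ→ℚ ((n + e) C n))        ≡⟨ regroup₁ (inv! s) (inv! (n + e)) (sgn n) (ℕ→ℚ ((n + e) C n)) ⟩
  sgn n * inv! s * (inv! (n + e) * ℕ→ℚ ((n + e) C n))        ≡⟨ cong (sgn n * inv! s *_) (inv!-*-ℕ→ℚ[m+nCm] n e) ⟩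
  sgn n * inv! s * (inv! n * inv! e)                         ≡⟨ ℚ.*-assoc (sgn n * inv! s) (inv! n) (inv! e) ⟨
  sgn n * inv! s * inv! n * inv! e                           ∎
  where
  regroup₁ : ∀ a b c d → a * b * (c * d) ≡ c * a * (b * d)
  regroup₁ = solve-∀ ℚ-ring

sgn-split : ∀ s n j → s + n ≡ suc j → sgn j * sgn s ≡ - sgn n
sgn-split s n j s+n≡1+j = begin
  sgn j * sgn s               ≡⟨ regroup₁ (sgn j) (sgn s) ⟩
  - (- sgn j * sgn s)         ≡⟨ cong (λ x → - (x * sgn s)) (trans (cong sgn (sym s+n≡1+j)) (sgn-+ s n)) ⟩
  - (sgn s * sgn n * sgn s)   ≡⟨ regroup₂ (sgn s) (sgn n) ⟩
  - (sgn s * sgn s * sgn n)   ≡⟨ cong (λ x → - (x * sgn n)) (sgn-*-sgn s) ⟩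
  - (1ℚ * sgn n)              ≡⟨ cong -_ (ℚ.*-identityˡ (sgn n)) ⟩
  - sgn n                     ∎
  where
  regroup₁ : ∀ a b → a * b ≡ - (- a * b)
  regroup₁ = solve-∀ ℚ-ring
  regroup₂ : ∀ a b → - (a * b * a) ≡ - (a * a * b)
  regroup₂ = solve-∀ ℚ-ring

signedBinomial-factorials : ∀ s n j → s + n ≡ suc j →
  sgn j * inv! j * (sgn s * ℕ→ℚ (suc j C s)) ≡ - (ℕ→ℚ (suc j) * sgn n * inv! s * inv! n)
signedBinomial-factorials s n j s+n≡1+j = begin
  sgn j * inv! j * (sgn s * ℕ→ℚ (suc j C s))                     ≡⟨ cong (λ x → sgn j * inv! j * (sgn s * x)) binomial ⟩
  sgn j * inv! j * (sgn s * (ℕ→ℚ (suc j !) * inv! s * inv! n))   ≡⟨ regroup₁ (sgn j) (inv! j) (sgn s) (ℕ→ℚ (suc j !)) (inv! s) (inv! n) ⟩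
  sgn j * sgn s * (inv! j * ℕ→ℚ (suc j !)) * inv! s * inv! n     ≡⟨ cong₂ (λ x y → x * y * inv! s * inv! n) (sgn-split s n j s+n≡1+j) (inv!-*-suc! j) ⟩
  - sgn n * ℕ→ℚ (suc j) * inv! s * inv! n                        ≡⟨ regroup₂ (sgn n) (ℕ→ℚ (suc j)) (inv! s) (inv! n) ⟩
  - (ℕ→ℚ (suc j) * sgn n * inv! s * inv! n)                      ∎
  where
  binomial : ℕ→ℚ (suc j C s) ≡ ℕ→ℚ (suc j !) * inv! s * inv! n
  binomial = subst (λ m → ℕ→ℚ (m C s) ≡ ℕ→ℚ (m !) * inv! s * inv! n) s+n≡1+j (ℕ→ℚ[m+nCm] s n)
  regroup₁ : ∀ a b c f d e → a * b * (c * (f * d * e)) ≡ a * c * (b * f) * d * e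
  regroup₁ = solve-∀ ℚ-ring
  regroup₂ : ∀ a b c d → - a * b * c * d ≡ - (b * a * c * d)
  regroup₂ = solve-∀ ℚ-ring

-- With s = m - 1 and t = k - m, this is the factor ((k - m)/(1 - x) - (m - 1)/x) x^(m-1) (1 - x)^(k-m) of P_π.
gradCoeff : ℕ → ℕ → Poly1
gradCoeff s t = ℕ→ℚ t ·₁ bern s (t ∸ 1) ⊖₁ ℕ→ℚ s ·₁ bern (s ∸ 1) t

gradCoeff-derivative-+ : ∀ s t n {j} → s + n ≡ suc j → gradCoeff s t j ≡ - (ℕ→ℚ (suc j) * bern s t (suc j))
gradCoeff-derivative-+ zero    t n {j} refl = begin
  ℕ→ℚ t * sbin (t ∸ 1) j - 0ℚ * sbin t j   ≡⟨ cong (λ x → ℕ→ℚ t * sbin (t ∸ 1) j - x) (ℚ.*-zeroˡ (sbin t j)) ⟩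
  ℕ→ℚ t * sbin (t ∸ 1) j ℚ.+ 0ℚ            ≡⟨ ℚ.+-identityʳ (ℕ→ℚ t * sbin (t ∸ 1) j) ⟩
  ℕ→ℚ t * sbin (t ∸ 1) j                   ≡⟨ absorption-sbin t j ⟩
  - (ℕ→ℚ (suc j) * sbin t (suc j))         ∎
gradCoeff-derivative-+ (suc s) t n     refl = begin
  ℕ→ℚ t * shift (suc s) (sbin (t ∸ 1)) (s + n) - ℕ→ℚ (suc s) * shift s (sbin t) (s + n)
    ≡⟨ cong₂ _-_ (first-term n) (cong (ℕ→ℚ (suc s) *_) (shift-+ s (sbin t) n)) ⟩
  - (ℕ→ℚ n * sbin t n) - ℕ→ℚ (suc s) * sbin t n
    ≡⟨ combine (ℕ→ℚ n) (ℕ→ℚ (suc s)) (sbin t n) ⟩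
  - ((ℕ→ℚ (suc s) ℚ.+ ℕ→ℚ n) * sbin t n)
    ≡⟨ cong (λ x → - (x * sbin t n)) (ℕ→ℚ-+ (suc s) n) ⟨
  - (ℕ→ℚ (suc s + n) * sbin t n)
    ≡⟨ cong (λ x → - (ℕ→ℚ (suc s + n) * x)) (shift-+ s (sbin t) n) ⟨
  - (ℕ→ℚ (suc s + n) * bern (suc s) t (suc s + n))
    ∎
  where
  first-term : ∀ n → ℕ→ℚ t * shift (suc s) (sbin (t ∸ 1)) (s + n) ≡ - (ℕ→ℚ n * sbin t n)
  first-term zero    = begin
    ℕ→ℚ t * shift (suc s) (sbin (t ∸ 1)) (s + 0)  ≡⟨ cong (ℕ→ℚ t *_) (shift-< (suc s) (sbin (t ∸ 1)) (s≤s (ℕ.≤-reflexive (ℕ.+-identityʳ s)))) ⟩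
    ℕ→ℚ t * 0ℚ                                    ≡⟨ ℚ.*-zeroʳ (ℕ→ℚ t) ⟩
    - 0ℚ                                          ≡⟨ cong -_ (ℚ.*-zeroˡ (sbin t 0)) ⟨
    - (0ℚ * sbin t 0)                             ∎
  first-term (suc n) = begin
    ℕ→ℚ t * shift (suc s) (sbin (t ∸ 1)) (s + suc n)  ≡⟨ cong (λ x → ℕ→ℚ t * shift (suc s) (sbin (t ∸ 1)) x) (ℕ.+-suc s n) ⟩
    ℕ→ℚ t * shift s (sbin (t ∸ 1)) (s + n)            ≡⟨ cong (ℕ→ℚ t *_) (shift-+ s (sbin (t ∸ 1)) n) ⟩
    ℕ→ℚ t * sbin (t ∸ 1) n                            ≡⟨ absorption-sbin t n ⟩
    - (ℕ→ℚ (suc n) * sbin t (suc n))                  ∎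
  combine : ∀ a b c → - (a * c) - b * c ≡ - ((b ℚ.+ a) * c)
  combine = solve-∀ ℚ-ring

gradCoeff-derivative-< : ∀ s t {j} → suc j < s → gradCoeff s t j ≡ - (ℕ→ℚ (suc j) * bern s t (suc j))
gradCoeff-derivative-< s t {j} 1+j<s = begin
  ℕ→ℚ t * bern s (t ∸ 1) j - ℕ→ℚ s * bern (s ∸ 1) t j
    ≡⟨ cong₂ (λ x y → ℕ→ℚ t * x - ℕ→ℚ s * y) (shift-< s (sbin (t ∸ 1)) j<s) (shift-< (s ∸ 1) (sbin t) j<s∸1) ⟩
  ℕ→ℚ t * 0ℚ - ℕ→ℚ s * 0ℚ
    ≡⟨ cong₂ _-_ (ℚ.*-zeroʳ (ℕ→ℚ t)) (ℚ.*-zeroʳ (ℕ→ℚ s)) ⟩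
  0ℚ - 0ℚ
    ≡⟨ ℚ.+-inverseʳ 0ℚ ⟩
  0ℚ
    ≡⟨ cong -_ (ℚ.*-zeroʳ (ℕ→ℚ (suc j))) ⟨
  - (ℕ→ℚ (suc j) * 0ℚ)
    ≡⟨ cong (λ x → - (ℕ→ℚ (suc j) * x)) (shift-< s (sbin t) 1+j<s) ⟨
  - (ℕ→ℚ (suc j) * bern s t (suc j))
    ∎
  where
  j<s : j < s
  j<s = ℕ.<-trans (ℕ.n<1+n j) 1+j<s
  j<s∸1 : j < s ∸ 1
  j<s∸1 = ℕ.∸-monoˡ-≤ 1 1+j<s

gradCoeff-derivative : ∀ s t j → gradCoeff s t j ≡ - (ℕ→ℚ (suc j) * bern s t (suc j))
gradCoeff-derivative s t j =
  [ (λ s≤1+j → gradCoeff-derivative-+ s t (suc j ∸ s) (ℕ.m+[n∸m]≡n s≤1+j)) , gradCoeff-derivative-< s t ]′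
    (ℕ.≤-<-connex s (suc j))

gradCoeff-vanishes : ∀ s t {j} → s + t ≤ j → gradCoeff s t j ≡ 0ℚ
gradCoeff-vanishes s t {j} s+t≤j = begin
  gradCoeff s t j                       ≡⟨ gradCoeff-derivative s t j ⟩
  - (ℕ→ℚ (suc j) * bern s t (suc j))    ≡⟨ cong (λ x → - (ℕ→ℚ (suc j) * x)) (bern-vanishes s t (s≤s s+t≤j)) ⟩
  - (ℕ→ℚ (suc j) * 0ℚ)                  ≡⟨ cong -_ (ℚ.*-zeroʳ (ℕ→ℚ (suc j))) ⟩
  0ℚ                                    ∎

gradCoeff-closed : ∀ s t j e → suc j + e ≡ s + t →
  inv! s * inv! t * gradCoeff s t j ≡ sgn j * inv! j * inv! e * (sgn s * ℕ→ℚ (suc j C s))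
gradCoeff-closed s t j e 1+j+e≡s+t =
  trans (cong (inv! s * inv! t *_) (gradCoeff-derivative s t j)) ([ s≤1+j-case , 1+j<s-case ]′ (ℕ.≤-<-connex s (suc j)))
  where
  goal : ℕ → Set
  goal t = inv! s * inv! t * - (ℕ→ℚ (suc j) * bern s t (suc j)) ≡ sgn j * inv! j * inv! e * (sgn s * ℕ→ℚ (suc j C s))

  regroup₁ : ∀ a b c d → a * b * - (c * d) ≡ - c * (a * b * d)
  regroup₁ = solve-∀ ℚ-ring
  regroup₂ : ∀ c sn is in′ ie → - c * (sn * is * in′ * ie) ≡ ie * - (c * sn * is * in′)
  regroup₂ = solve-∀ ℚ-ring
  regroup₃ : ∀ ie sj ij x → ie * (sj * ij * x) ≡ sj * ij * ie * x
  regroup₃ = solve-∀ ℚ-ring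

  s≤1+j-case : s ≤ suc j → goal t
  s≤1+j-case s≤1+j = subst goal n+e≡t (begin
    inv! s * inv! (n + e) * - (ℕ→ℚ (suc j) * bern s (n + e) (suc j))
      ≡⟨ cong (λ i → inv! s * inv! (n + e) * - (ℕ→ℚ (suc j) * bern s (n + e) i)) (sym s+n≡1+j) ⟩
    inv! s * inv! (n + e) * - (ℕ→ℚ (suc j) * bern s (n + e) (s + n))
      ≡⟨ regroup₁ (inv! s) (inv! (n + e)) (ℕ→ℚ (suc j)) (bern s (n + e) (s + n)) ⟩
    - ℕ→ℚ (suc j) * (inv! s * inv! (n + e) * bern s (n + e) (s + n))
      ≡⟨ cong (- ℕ→ℚ (suc j) *_) (bern-coeff s n e) ⟩
    - ℕ→ℚ (suc j) * (sgn n * inv! s * inv! n * inv! e)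
      ≡⟨ regroup₂ (ℕ→ℚ (suc j)) (sgn n) (inv! s) (inv! n) (inv! e) ⟩
    inv! e * - (ℕ→ℚ (suc j) * sgn n * inv! s * inv! n)
      ≡⟨ cong (inv! e *_) (signedBinomial-factorials s n j s+n≡1+j) ⟨
    inv! e * (sgn j * inv! j * (sgn s * ℕ→ℚ (suc j C s)))
      ≡⟨ regroup₃ (inv! e) (sgn j) (inv! j) (sgn s * ℕ→ℚ (suc j C s)) ⟩
    sgn j * inv! j * inv! e * (sgn s * ℕ→ℚ (suc j C s))
      ∎)
    where
    n = suc j ∸ s
    s+n≡1+j : s + n ≡ suc j
    s+n≡1+j = ℕ.m+[n∸m]≡n s≤1+j
    n+e≡t : n + e ≡ t
    n+e≡t = ℕ.+-cancelˡ-≡ s (n + e) t (trans (sym (ℕ.+-assoc s n e)) (trans (cong (_+ e) s+n≡1+j) 1+j+e≡s+t))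

  1+j<s-case : suc j < s → goal t
  1+j<s-case 1+j<s = begin
    inv! s * inv! t * - (ℕ→ℚ (suc j) * bern s t (suc j))
      ≡⟨ cong (λ x → inv! s * inv! t * - (ℕ→ℚ (suc j) * x)) (shift-< s (sbin t) 1+j<s) ⟩
    inv! s * inv! t * - (ℕ→ℚ (suc j) * 0ℚ)
      ≡⟨ cong (λ x → inv! s * inv! t * - x) (ℚ.*-zeroʳ (ℕ→ℚ (suc j))) ⟩
    inv! s * inv! t * - 0ℚ
      ≡⟨ ℚ.*-zeroʳ (inv! s * inv! t) ⟩
    0ℚ
      ≡⟨ ℚ.*-zeroʳ (sgn j * inv! j * inv! e) ⟨
    sgn j * inv! j * inv! e * 0ℚ
      ≡⟨ cong (sgn j * inv! j * inv! e *_) (ℚ.*-zeroʳ (sgn s)) ⟨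
    sgn j * inv! j * inv! e * (sgn s * 0ℚ)
      ≡⟨ cong (λ x → sgn j * inv! j * inv! e * (sgn s * ℕ→ℚ x)) (k>n⇒nCk≡0 1+j<s) ⟨
    sgn j * inv! j * inv! e * (sgn s * ℕ→ℚ (suc j C s))
      ∎

gradFactor₁ : ℕ → ℕ → Poly1 → Poly1
gradFactor₁ k r f =
    ℕ→ℚ (k ∸ suc r) ·₁ (f ^ r) ⋆ ((𝟙 ⊖₁ f) ^ (k ∸ suc r ∸ 1))
  ⊖₁ ℕ→ℚ r ·₁ (f ^ (r ∸ 1)) ⋆ ((𝟙 ⊖₁ f) ^ (k ∸ suc r))

gradFactor₁-X : ∀ k s → gradFactor₁ k s X ≗ gradCoeff s (k ∸ suc s)
gradFactor₁-X k s j = cong₂ _-_ (term (ℕ→ℚ t) s (t ∸ 1)) (term (ℕ→ℚ s) (s ∸ 1) t)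
  where
  t = k ∸ suc s
  term : ∀ c a b → (c ·₁ X ^ a ⋆ (𝟙 ⊖₁ X) ^ b) j ≡ c * bern a b j
  term c a b = trans (·₁-⋆ c (X ^ a) ((𝟙 ⊖₁ X) ^ b) j) (cong (c *_) (X^⋆[1-X]^ a b j))

gradFactor₁-1-X : ∀ k r i → gradFactor₁ k r (𝟙 ⊖₁ X) i ≡ - gradCoeff (k ∸ suc r) r i
gradFactor₁-1-X k r i = begin
  gradFactor₁ k r (𝟙 ⊖₁ X) i
    ≡⟨ cong₂ _-_ (term (ℕ→ℚ t) r (t ∸ 1)) (term (ℕ→ℚ r) (r ∸ 1) t) ⟩
  ℕ→ℚ t * bern (t ∸ 1) r i - ℕ→ℚ r * bern t (r ∸ 1) i
    ≡⟨ antisym (ℕ→ℚ t * bern (t ∸ 1) r i) (ℕ→ℚ r * bern t (r ∸ 1) i) ⟩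
  - gradCoeff t r i
    ∎
  where
  t = k ∸ suc r
  1-[1-X] : 𝟙 ⊖₁ (𝟙 ⊖₁ X) ≗ X
  1-[1-X] i = cancel (𝟙 i) (X i)
    where
    cancel : ∀ a b → a - (a - b) ≡ b
    cancel = solve-∀ ℚ-ring
  term : ∀ c a b → (c ·₁ (𝟙 ⊖₁ X) ^ a ⋆ (𝟙 ⊖₁ (𝟙 ⊖₁ X)) ^ b) i ≡ c * bern b a i
  term c a b = begin
    (c ·₁ (𝟙 ⊖₁ X) ^ a ⋆ (𝟙 ⊖₁ (𝟙 ⊖₁ X)) ^ b) i   ≡⟨ ·₁-⋆ c ((𝟙 ⊖₁ X) ^ a) ((𝟙 ⊖₁ (𝟙 ⊖₁ X)) ^ b) i ⟩
    c * ((𝟙 ⊖₁ X) ^ a ⋆ (𝟙 ⊖₁ (𝟙 ⊖₁ X)) ^ b) i     ≡⟨ cong (c *_) (⋆-congʳ ((𝟙 ⊖₁ X) ^ a) (^-cong 1-[1-X] b) i) ⟩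
    c * ((𝟙 ⊖₁ X) ^ a ⋆ X ^ b) i                   ≡⟨ cong (c *_) (⋆-comm ((𝟙 ⊖₁ X) ^ a) (X ^ b) i) ⟩
    c * (X ^ b ⋆ (𝟙 ⊖₁ X) ^ a) i                   ≡⟨ cong (c *_) (X^⋆[1-X]^ b a i) ⟩
    c * bern b a i                                 ∎
  antisym : ∀ a b → a - b ≡ - (b - a)
  antisym = solve-∀ ℚ-ring

-- Bivariate polynomials

infix 4 _≋_
_≋_ : Poly2 → Poly2 → Set
P ≋ Q = ∀ i j → P i j ≡ Q i j

≋-trans : ∀ {P Q R} → P ≋ Q → Q ≋ R → P ≋ R
≋-trans P≋Q Q≋R i j = trans (P≋Q i j) (Q≋R i j)

⊗-cong : ∀ {P P′ Q Q′} → P ≋ P′ → Q ≋ Q′ → P ⊗ Q ≋ P′ ⊗ Q′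
⊗-cong P≋P′ Q≋Q′ i j = Σ≤-cong i (λ a _ → Σ≤-cong j (λ b _ → cong₂ _*_ (P≋P′ a b) (Q≋Q′ (i ∸ a) (j ∸ b))))

⊖-cong : ∀ {P P′ Q Q′} → P ≋ P′ → Q ≋ Q′ → P ⊖ Q ≋ P′ ⊖ Q′
⊖-cong P≋P′ Q≋Q′ i j = cong₂ _-_ (P≋P′ i j) (Q≋Q′ i j)

·-congʳ : ∀ c {P P′} → P ≋ P′ → c · P ≋ c · P′
·-congʳ c P≋P′ i j = cong (c *_) (P≋P′ i j)

_⊠_ : Poly1 → Poly1 → Poly2
(f ⊠ g) i j = f i * g j

⊠-cong : ∀ {f f′ g g′} → f ≗ f′ → g ≗ g′ → f ⊠ g ≋ f′ ⊠ g′
⊠-cong f≗f′ g≗g′ i j = cong₂ _*_ (f≗f′ i) (g≗g′ j)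

⊠-congˡ : ∀ {f f′} g → f ≗ f′ → f ⊠ g ≋ f′ ⊠ g
⊠-congˡ g f≗f′ = ⊠-cong f≗f′ (λ _ → refl)

⊠-congʳ : ∀ f {g g′} → g ≗ g′ → f ⊠ g ≋ f ⊠ g′
⊠-congʳ f = ⊠-cong {f} {f} (λ _ → refl)

⊠-⊗ : ∀ f g f′ g′ → (f ⊠ g) ⊗ (f′ ⊠ g′) ≋ (f ⋆ f′) ⊠ (g ⋆ g′)
⊠-⊗ f g f′ g′ i j = sym (begin
  Σ≤ i (λ a → f a * f′ (i ∸ a)) * Σ≤ j (λ b → g b * g′ (j ∸ b))
    ≡⟨ Σ≤-*-Σ≤ i j (λ a → f a * f′ (i ∸ a)) (λ b → g b * g′ (j ∸ b)) ⟩
  Σ≤ i (λ a → Σ≤ j (λ b → f a * f′ (i ∸ a) * (g b * g′ (j ∸ b))))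
    ≡⟨ Σ≤-cong i (λ a _ → Σ≤-cong j (λ b _ → regroup (f a) (f′ (i ∸ a)) (g b) (g′ (j ∸ b)))) ⟩
  Σ≤ i (λ a → Σ≤ j (λ b → f a * g b * (f′ (i ∸ a) * g′ (j ∸ b))))
    ∎)
  where
  regroup : ∀ x x′ y y′ → x * x′ * (y * y′) ≡ x * y * (x′ * y′)
  regroup = solve-∀ ℚ-ring

⊠-⊖ˡ : ∀ f g h → f ⊠ h ⊖ g ⊠ h ≋ (f ⊖₁ g) ⊠ h
⊠-⊖ˡ f g h i j = distrib (f i) (g i) (h j)
  where
  distrib : ∀ x y z → x * z - y * z ≡ (x - y) * z
  distrib = solve-∀ ℚ-ring

⊠-⊖ʳ : ∀ h f g → h ⊠ f ⊖ h ⊠ g ≋ h ⊠ (f ⊖₁ g)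
⊠-⊖ʳ h f g i j = distrib (h i) (f j) (g j)
  where
  distrib : ∀ z x y → z * x - z * y ≡ z * (x - y)
  distrib = solve-∀ ℚ-ring

⊠-·ˡ : ∀ c f g → c · (f ⊠ g) ≋ (c ·₁ f) ⊠ g
⊠-·ˡ c f g i j = sym (ℚ.*-assoc c (f i) (g j))

⊠-·ʳ : ∀ c f g → c · (f ⊠ g) ≋ f ⊠ (c ·₁ g)
⊠-·ʳ c f g i j = regroup c (f i) (g j)
  where
  regroup : ∀ c x y → c * (x * y) ≡ x * (c * y)
  regroup = solve-∀ ℚ-ring

oneP≋𝟙⊠𝟙 : oneP ≋ 𝟙 ⊠ 𝟙
oneP≋𝟙⊠𝟙 zero    zero    = sym (ℚ.*-identityˡ 1ℚ)
oneP≋𝟙⊠𝟙 zero    (suc j) = sym (ℚ.*-zeroʳ 1ℚ)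
oneP≋𝟙⊠𝟙 (suc i) j       = sym (ℚ.*-zeroˡ (𝟙 j))

αP≋X⊠𝟙 : αP ≋ X ⊠ 𝟙
αP≋X⊠𝟙 zero          j       = sym (ℚ.*-zeroˡ (𝟙 j))
αP≋X⊠𝟙 (suc zero)    zero    = sym (ℚ.*-identityˡ 1ℚ)
αP≋X⊠𝟙 (suc zero)    (suc j) = sym (ℚ.*-zeroʳ 1ℚ)
αP≋X⊠𝟙 (suc (suc i)) j       = sym (ℚ.*-zeroˡ (𝟙 j))

βP≋𝟙⊠X : βP ≋ 𝟙 ⊠ X
βP≋𝟙⊠X zero    zero          = sym (ℚ.*-zeroʳ 1ℚ)
βP≋𝟙⊠X zero    (suc zero)    = sym (ℚ.*-identityˡ 1ℚ)
βP≋𝟙⊠X zero    (suc (suc j)) = sym (ℚ.*-zeroʳ 1ℚ)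
βP≋𝟙⊠X (suc i) j             = sym (ℚ.*-zeroˡ (X j))

module Embedding
  (e : Poly1 → Poly2)
  (e-⋆ : ∀ f g → e f ⊗ e g ≋ e (f ⋆ g))
  (e-⊖₁ : ∀ f g → e f ⊖ e g ≋ e (f ⊖₁ g))
  (e-·₁ : ∀ c f → c · e f ≋ e (c ·₁ f))
  (e-𝟙 : oneP ≋ e 𝟙)
  where

  e-^ : ∀ {a} f → a ≋ e f → ∀ n → a ^P n ≋ e (f ^ n)
  e-^ f a≋ef zero    = e-𝟙
  e-^ f a≋ef (suc n) = ≋-trans (⊗-cong a≋ef (e-^ f a≋ef n)) (e-⋆ f (f ^ n))

  gradFactor-e : ∀ k r {a} f → a ≋ e f → gradFactor k r a ≋ e (gradFactor₁ k r f)
  gradFactor-e k r {a} f a≋ef =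
    ≋-trans (⊖-cong (term (ℕ→ℚ (k ∸ suc r)) r (k ∸ suc r ∸ 1)) (term (ℕ→ℚ r) (r ∸ 1) (k ∸ suc r))) (e-⊖₁ _ _)
    where
    1-a≋e[1-f] : oneP ⊖ a ≋ e (𝟙 ⊖₁ f)
    1-a≋e[1-f] = ≋-trans (⊖-cong e-𝟙 a≋ef) (e-⊖₁ 𝟙 f)
    term : ∀ c m n → c · (a ^P m) ⊗ ((oneP ⊖ a) ^P n) ≋ e (c ·₁ (f ^ m) ⋆ ((𝟙 ⊖₁ f) ^ n))
    term c m n = ≋-trans (⊗-cong (≋-trans (·-congʳ c (e-^ f a≋ef m)) (e-·₁ c (f ^ m))) (e-^ (𝟙 ⊖₁ f) 1-a≋e[1-f] n))
                         (e-⋆ (c ·₁ (f ^ m)) ((𝟙 ⊖₁ f) ^ n))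

module α-Embedding = Embedding (_⊠ 𝟙)
  (λ f g → ≋-trans (⊠-⊗ f 𝟙 g 𝟙) (⊠-congʳ (f ⋆ g) (𝟙-⋆ 𝟙)))
  (λ f g → ⊠-⊖ˡ f g 𝟙) (λ c f → ⊠-·ˡ c f 𝟙) oneP≋𝟙⊠𝟙

module β-Embedding = Embedding (𝟙 ⊠_)
  (λ f g → ≋-trans (⊠-⊗ 𝟙 f 𝟙 g) (⊠-congˡ (f ⋆ g) (𝟙-⋆ 𝟙)))
  (⊠-⊖ʳ 𝟙) (λ c f → ⊠-·ʳ c 𝟙 f) oneP≋𝟙⊠𝟙

gradFactor-1-α : ∀ k r → gradFactor k r (oneP ⊖ αP) ≋ (λ i → - gradCoeff (k ∸ suc r) r i) ⊠ 𝟙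
gradFactor-1-α k r = ≋-trans (α-Embedding.gradFactor-e k r (𝟙 ⊖₁ X) 1-α≋[1-X]⊠𝟙) (⊠-congˡ 𝟙 (gradFactor₁-1-X k r))
  where
  1-α≋[1-X]⊠𝟙 : oneP ⊖ αP ≋ (𝟙 ⊖₁ X) ⊠ 𝟙
  1-α≋[1-X]⊠𝟙 = ≋-trans (⊖-cong oneP≋𝟙⊠𝟙 αP≋X⊠𝟙) (⊠-⊖ˡ 𝟙 X 𝟙)

gradFactor-β : ∀ k s → gradFactor k s βP ≋ 𝟙 ⊠ gradCoeff s (k ∸ suc s)
gradFactor-β k s = ≋-trans (β-Embedding.gradFactor-e k s X βP≋𝟙⊠X) (⊠-congʳ 𝟙 (gradFactor₁-X k s))

-- The bilinear form

bvec-entry : ∀ {k} a (x : Fin k) → bvec k (suc a) x ≡ sgn (toℕ x) * ℕ→ℚ (a C toℕ x)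
bvec-entry a x with toℕ x ℕ.<? suc a
... | yes _     = refl
... | no  x≮1+a = sym (trans (cong (λ c → sgn (toℕ x) * ℕ→ℚ c) (k>n⇒nCk≡0 (ℕ.≤-pred (ℕ.≰⇒> x≮1+a)))) (ℚ.*-zeroʳ (sgn (toℕ x))))

permMatrix-on : ∀ {k} (π : Permutation′ k) x → permMatrix π x (π ⟨$⟩ʳ x) ≡ 1ℚ
permMatrix-on π x with π ⟨$⟩ʳ x Fin.≟ π ⟨$⟩ʳ x
... | yes _  = refl
... | no  ≢x = contradiction refl ≢x

permMatrix-off : ∀ {k} (π : Permutation′ k) x y → y ≢ π ⟨$⟩ʳ x → permMatrix π x y ≡ 0ℚ
permMatrix-off π x y y≢πx with π ⟨$⟩ʳ x Fin.≟ y
... | yes πx≡y = contradiction (sym πx≡y) y≢πx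
... | no  _    = refl

bilinear-rowMirror-permMatrix : ∀ {k} (π : Permutation′ k) u v →
  bilinear u (rowMirror (permMatrix π)) v ≡ ΣFin k (λ m → u (opposite m) * v (π ⟨$⟩ʳ m))
bilinear-rowMirror-permMatrix {k} π u v = begin
  ΣFin k (λ x → ΣFin k (λ y → u x * permMatrix π (opposite x) y * v y))
    ≡⟨ ΣFin-cong k (λ x → ΣFin-δ (π ⟨$⟩ʳ opposite x) _ (λ y y≢ → off x y y≢)) ⟩
  ΣFin k (λ x → u x * permMatrix π (opposite x) (π ⟨$⟩ʳ opposite x) * v (π ⟨$⟩ʳ opposite x))
    ≡⟨ ΣFin-cong k (λ x → on x) ⟩
  ΣFin k (λ x → u (opposite (opposite x)) * v (π ⟨$⟩ʳ opposite x))
    ≡⟨ ΣFin-opposite k (λ m → u (opposite m) * v (π ⟨$⟩ʳ m)) ⟩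
  ΣFin k (λ m → u (opposite m) * v (π ⟨$⟩ʳ m))
    ∎
  where
  off : ∀ x y → y ≢ π ⟨$⟩ʳ opposite x → u x * permMatrix π (opposite x) y * v y ≡ 0ℚ
  off x y y≢ = begin
    u x * permMatrix π (opposite x) y * v y   ≡⟨ cong (λ c → u x * c * v y) (permMatrix-off π (opposite x) y y≢) ⟩
    u x * 0ℚ * v y                            ≡⟨ cong (_* v y) (ℚ.*-zeroʳ (u x)) ⟩
    0ℚ * v y                                  ≡⟨ ℚ.*-zeroˡ (v y) ⟩
    0ℚ                                        ∎
  on : ∀ x → u x * permMatrix π (opposite x) (π ⟨$⟩ʳ opposite x) * v (π ⟨$⟩ʳ opposite x)
           ≡ u (opposite (opposite x)) * v (π ⟨$⟩ʳ opposite x)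
  on x = begin
    u x * permMatrix π (opposite x) (π ⟨$⟩ʳ opposite x) * v (π ⟨$⟩ʳ opposite x)
      ≡⟨ cong (λ c → u x * c * v (π ⟨$⟩ʳ opposite x)) (permMatrix-on π (opposite x)) ⟩
    u x * 1ℚ * v (π ⟨$⟩ʳ opposite x)
      ≡⟨ cong (λ y → u y * 1ℚ * v (π ⟨$⟩ʳ opposite x)) (Fin.opposite-involutive x) ⟨
    u (opposite (opposite x)) * 1ℚ * v (π ⟨$⟩ʳ opposite x)
      ≡⟨ cong (_* v (π ⟨$⟩ʳ opposite x)) (ℚ.*-identityʳ (u (opposite (opposite x)))) ⟩
    u (opposite (opposite x)) * v (π ⟨$⟩ʳ opposite x)
      ∎

-- Coefficients of the mirror gradient polynomial

separable-coeff : ∀ c {A B} f g → A ≋ f ⊠ 𝟙 → B ≋ 𝟙 ⊠ g → ∀ i j → (c · A ⊗ B) i j ≡ c * f i * g j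
separable-coeff c {A} {B} f g A≋f⊠𝟙 B≋𝟙⊠g i j = begin
  (c · A ⊗ B) i j                ≡⟨ ≋-trans (⊗-cong (≋-trans (·-congʳ c A≋f⊠𝟙) (⊠-·ˡ c f 𝟙)) B≋𝟙⊠g) (⊠-⊗ (c ·₁ f) 𝟙 𝟙 g) i j ⟩
  (c ·₁ f ⋆ 𝟙) i * (𝟙 ⋆ g) j     ≡⟨ cong₂ _*_ (⋆-𝟙 (c ·₁ f) i) (𝟙-⋆ g j) ⟩
  c * f i * g j                  ∎

gradWeight : ℕ → ℕ → ℕ → ℚ
gradWeight k r s = ℕ→ℚ (k !) * inv! r * inv! (k ∸ suc r) * inv! s * inv! (k ∸ suc s)

PbarSummand : ∀ {k} → Permutation′ k → ℕ → ℕ → Fin k → ℚ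
PbarSummand {k} π i j m =
  let r = toℕ m ; s = toℕ (π ⟨$⟩ʳ m) in
  gradWeight k r s * - gradCoeff (k ∸ suc r) r i * gradCoeff s (k ∸ suc s) j

coeff-Pbar : ∀ {k} (π : Permutation′ k) i j → coeff i j (Pbar π) ≡ ΣFin k (PbarSummand π i j)
coeff-Pbar {k} π i j = ΣFin-cong k λ m →
  let r = toℕ m ; s = toℕ (π ⟨$⟩ʳ m) in
  separable-coeff (gradWeight k r s) (λ i → - gradCoeff (k ∸ suc r) r i) (gradCoeff s (k ∸ suc s))
                  (gradFactor-1-α k r) (gradFactor-β k s) i j

complement-+ : ∀ {r k} → r < k → suc (k ∸ suc r + r) ≡ k
complement-+ {r} r<k = trans (sym (ℕ.+-suc _ r)) (ℕ.m∸n+n≡m r<k)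

+-complement : ∀ {s k} → s < k → suc (s + (k ∸ suc s)) ≡ k
+-complement {s} {k} s<k = trans (cong suc (ℕ.+-comm s (k ∸ suc s))) (complement-+ s<k)

i+2≰1+m⇒m≤i : ∀ {m k i} → suc m ≡ k → ¬ (i + 2 ≤ k) → m ≤ i
i+2≰1+m⇒m≤i {m} {i = i} refl i+2≰1+m = ℕ.≤-pred (ℕ.≤-pred (subst (suc (suc m) ≤_) (ℕ.+-comm i 2) (ℕ.≰⇒> i+2≰1+m)))

gradCoeff≡bvec : ∀ {k} s t j (x : Fin k) → toℕ x ≡ s → suc (s + t) ≡ k → j + 2 ≤ k →
  inv! s * inv! t * gradCoeff s t j ≡ sgn j * inv! j * inv! (k ∸ j ∸ 2) * bvec k (j + 2) x
gradCoeff≡bvec {k} s t j x refl 1+s+t≡k j+2≤k = begin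
  inv! s * inv! t * gradCoeff s t j                               ≡⟨ gradCoeff-closed s t j (k ∸ j ∸ 2) 1+j+e≡s+t ⟩
  sgn j * inv! j * inv! (k ∸ j ∸ 2) * (sgn s * ℕ→ℚ (suc j C s))   ≡⟨ cong (sgn j * inv! j * inv! (k ∸ j ∸ 2) *_) entry ⟨
  sgn j * inv! j * inv! (k ∸ j ∸ 2) * bvec k (j + 2) x            ∎
  where
  entry : bvec k (j + 2) x ≡ sgn s * ℕ→ℚ (suc j C s)
  entry = trans (cong (λ a → bvec k a x) (ℕ.+-comm j 2)) (bvec-entry (suc j) x)
  1+j≤s+t : suc j ≤ s + t
  1+j≤s+t = ℕ.≤-pred (subst₂ _≤_ (ℕ.+-comm j 2) (sym 1+s+t≡k) j+2≤k)
  1+j+e≡s+t : suc j + (k ∸ j ∸ 2) ≡ s + t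
  1+j+e≡s+t = begin
    suc j + (k ∸ j ∸ 2)              ≡⟨ cong (λ e → suc j + e) (ℕ.∸-+-assoc k j 2) ⟩
    suc j + (k ∸ (j + 2))            ≡⟨ cong₂ (λ k′ j′ → suc j + (k′ ∸ j′)) (sym 1+s+t≡k) (ℕ.+-comm j 2) ⟩
    suc j + (s + t ∸ suc j)          ≡⟨ ℕ.m+[n∸m]≡n 1+j≤s+t ⟩
    s + t                            ∎

PbarSummand-closed : ∀ {k} (π : Permutation′ k) i j m → i + 2 ≤ k → j + 2 ≤ k →
  PbarSummand π i j m
    ≡ ℕ→ℚ (k !) * sgn (i + j + 1) * inv! i * inv! j * inv! (k ∸ i ∸ 2) * inv! (k ∸ j ∸ 2)
      * (bvec k (i + 2) (opposite m) * bvec k (j + 2) (π ⟨$⟩ʳ m))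
PbarSummand-closed {k} π i j m i+2≤k j+2≤k = begin
  ℕ→ℚ (k !) * inv! r * inv! t * inv! s * inv! t′ * - gradCoeff t r i * gradCoeff s t′ j
    ≡⟨ regroup₁ (ℕ→ℚ (k !)) (inv! r) (inv! t) (inv! s) (inv! t′) (gradCoeff t r i) (gradCoeff s t′ j) ⟩
  ℕ→ℚ (k !) * - (inv! t * inv! r * gradCoeff t r i) * (inv! s * inv! t′ * gradCoeff s t′ j)
    ≡⟨ cong₂ (λ x y → ℕ→ℚ (k !) * - x * y) α-side β-side ⟩
  ℕ→ℚ (k !) * - (sgn i * inv! i * inv! (k ∸ i ∸ 2) * u) * (sgn j * inv! j * inv! (k ∸ j ∸ 2) * v)
    ≡⟨ regroup₂ (ℕ→ℚ (k !)) (sgn i) (sgn j) (inv! i) (inv! j) (inv! (k ∸ i ∸ 2)) (inv! (k ∸ j ∸ 2)) u v ⟩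
  ℕ→ℚ (k !) * - (sgn i * sgn j) * inv! i * inv! j * inv! (k ∸ i ∸ 2) * inv! (k ∸ j ∸ 2) * (u * v)
    ≡⟨ cong (λ x → ℕ→ℚ (k !) * x * inv! i * inv! j * inv! (k ∸ i ∸ 2) * inv! (k ∸ j ∸ 2) * (u * v)) sign ⟩
  ℕ→ℚ (k !) * sgn (i + j + 1) * inv! i * inv! j * inv! (k ∸ i ∸ 2) * inv! (k ∸ j ∸ 2) * (u * v)
    ∎
  where
  r = toℕ m
  s = toℕ (π ⟨$⟩ʳ m)
  t = k ∸ suc r
  t′ = k ∸ suc s
  u = bvec k (i + 2) (opposite m)
  v = bvec k (j + 2) (π ⟨$⟩ʳ m)
  α-side : inv! t * inv! r * gradCoeff t r i ≡ sgn i * inv! i * inv! (k ∸ i ∸ 2) * u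
  α-side = gradCoeff≡bvec t r i (opposite m) (Fin.opposite-prop m) (complement-+ (Fin.toℕ<n m)) i+2≤k
  β-side : inv! s * inv! t′ * gradCoeff s t′ j ≡ sgn j * inv! j * inv! (k ∸ j ∸ 2) * v
  β-side = gradCoeff≡bvec s t′ j (π ⟨$⟩ʳ m) refl (+-complement (Fin.toℕ<n (π ⟨$⟩ʳ m))) j+2≤k
  sign : - (sgn i * sgn j) ≡ sgn (i + j + 1)
  sign = sym (trans (cong sgn (ℕ.+-comm (i + j) 1)) (cong -_ (sgn-+ i j)))
  regroup₁ : ∀ F a b c d X Y → F * a * b * c * d * - X * Y ≡ F * - (b * a * X) * (c * d * Y)
  regroup₁ = solve-∀ ℚ-ring
  regroup₂ : ∀ F si sj ii ij ei ej u v →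
    F * - (si * ii * ei * u) * (sj * ij * ej * v) ≡ F * - (si * sj) * ii * ij * ei * ej * (u * v)
  regroup₂ = solve-∀ ℚ-ring

PbarSummand-vanishes : ∀ {k} (π : Permutation′ k) i j m → ¬ ((i + 2 ≤ k) × (j + 2 ≤ k)) → PbarSummand π i j m ≡ 0ℚ
PbarSummand-vanishes {k} π i j m ¬both = by-cases (i + 2 ℕ.≤? k)
  where
  r = toℕ m
  s = toℕ (π ⟨$⟩ʳ m)
  W = gradWeight k r s
  A = gradCoeff (k ∸ suc r) r i
  B = gradCoeff s (k ∸ suc s) j
  by-cases : Dec (i + 2 ≤ k) → W * - A * B ≡ 0ℚ
  by-cases (no i+2≰k) = begin
    W * - A * B      ≡⟨ cong (λ x → W * - x * B) (gradCoeff-vanishes (k ∸ suc r) r (i+2≰1+m⇒m≤i (complement-+ (Fin.toℕ<n m)) i+2≰k)) ⟩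
    W * - 0ℚ * B     ≡⟨ cong (_* B) (ℚ.*-zeroʳ W) ⟩
    0ℚ * B           ≡⟨ ℚ.*-zeroˡ B ⟩
    0ℚ               ∎
  by-cases (yes i+2≤k) = begin
    W * - A * B      ≡⟨ cong (W * - A *_) (gradCoeff-vanishes s (k ∸ suc s) (i+2≰1+m⇒m≤i (+-complement (Fin.toℕ<n (π ⟨$⟩ʳ m))) (¬both ∘ (i+2≤k ,_)))) ⟩
    W * - A * 0ℚ     ≡⟨ ℚ.*-zeroʳ (W * - A) ⟩
    0ℚ               ∎

lemma7 : (k : ℕ) (π : Permutation′ k) (i j : ℕ) →
  ((i + 2 ≤ k) × (j + 2 ≤ k) →
    coeff i j (Pbar π)
      ≡ ℕ→ℚ (k !) * sgn (i + j + 1)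
          * inv! i * inv! j * inv! (k ∸ i ∸ 2) * inv! (k ∸ j ∸ 2)
          * bilinear (bvec k (i + 2)) (rowMirror (permMatrix π)) (bvec k (j + 2)))
  × (¬ ((i + 2 ≤ k) × (j + 2 ≤ k)) → coeff i j (Pbar π) ≡ 0ℚ)
lemma7 k π i j = closed-form , vanishing
  where
  K = ℕ→ℚ (k !) * sgn (i + j + 1) * inv! i * inv! j * inv! (k ∸ i ∸ 2) * inv! (k ∸ j ∸ 2)
  u = bvec k (i + 2)
  v = bvec k (j + 2)
  closed-form : (i + 2 ≤ k) × (j + 2 ≤ k) → coeff i j (Pbar π) ≡ K * bilinear u (rowMirror (permMatrix π)) v
  closed-form (i+2≤k , j+2≤k) = begin
    coeff i j (Pbar π)                                  ≡⟨ coeff-Pbar π i j ⟩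
    ΣFin k (PbarSummand π i j)                          ≡⟨ ΣFin-cong k (λ m → PbarSummand-closed π i j m i+2≤k j+2≤k) ⟩
    ΣFin k (λ m → K * (u (opposite m) * v (π ⟨$⟩ʳ m)))   ≡⟨ *-distribˡ-ΣFin k K (λ m → u (opposite m) * v (π ⟨$⟩ʳ m)) ⟨
    K * ΣFin k (λ m → u (opposite m) * v (π ⟨$⟩ʳ m))     ≡⟨ cong (K *_) (bilinear-rowMirror-permMatrix π u v) ⟨
    K * bilinear u (rowMirror (permMatrix π)) v         ∎
  vanishing : ¬ ((i + 2 ≤ k) × (j + 2 ≤ k)) → coeff i j (Pbar π) ≡ 0ℚ
  vanishing ¬both = trans (coeff-Pbar π i j) (trans (ΣFin-cong k (λ m → PbarSummand-vanishes π i j m ¬both)) (ΣFin-0 k))
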